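{- Let $A\in\mathbb{R}_+^{n\times n}$. Suppose either $\tau\in\mathcal{T}_{ag}(A)$ and $k=o_\tau$, or $\tau\in\mathcal{C}^{\ge1}(A)$ and $k\in\operatorname{supp}(\tau)$. Let $i\neq k$ be any index in $\operatorname{supp}(\tau)$. Then $x^{(\tau,i)}\le_i x^{(\tau,k)}$.
   Context: Max algebra on $\mathbb{R}_+=[0,\infty)$ with $\oplus=\max$ and ordinary multiplication. $\mathcal{D}(A)$ is the digraph on $[n]$ with an edge $(i,j)$ of weight $a_{ij}$ whenever $a_{ij}\neq0$; walk weights are products of edge weights. A strategy is a map $\tau:\operatorname{supp}(\tau)\to\operatorname{supp}(\tau)$, $\operatorname{supp}(\tau)\subseteq[n]$, with $a_{i,\tau(i)}\neq0$; $\mathcal{D}(A^\tau)$ has edges $(i,\tau(i))$, $i\in\operatorname{supp}(\tau)$, with weights $a_{i,\tau(i)}$. Write $k\to_\tau i$ if $k=i$ or there is a walk from $k$ to $i$ in $\mathcal{D}(A^\tau)$; then $P^\tau_{ki}$ is the unique such walk not repeating nodes (weight $1$ if $k=i$). Define $x^{(\tau,k)}\in\mathbb{R}_+^n$ by $x^{(\tau,k)}_k=1$, $x^{(\tau,k)}_i=(w(P^\tau_{ki}))^{ -1}$ if $i\neq k$ and $k\to_\tau i$, and $x^{(\tau,k)}_i=0$ otherwise. A cycle of $\mathcal{D}(A)$ with distinct nodes $i_1,\dots,i_p$ is identified with the strategy $\tau(i_s)=i_{s+1}$, $\tau(i_p)=i_1$ on $\{i_1,\dots,i_p\}$. $\mathcal{C}^{\ge1}(A)$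 is the set of such cycles of weight $\ge1$. A germ is a strategy $\tau$ such that $\mathcal{D}(A^\tau)$ consists of one cycle and one nonempty walk from a node $o_\tau$ to a node of that cycle; it is admissible if the cycle has weight $\ge1$; $\mathcal{T}_{ag}(A)$ is the set of admissible germs. For $x,y\in\mathbb{R}_+^n$ and $i\in[n]$: $y\le_i x$ means $x_i\neq0$, $y_i\neq0$ and $y_ly_i^{ -1}\le x_lx_i^{ -1}$ for all $l\in[n]$. -}

module Defs where

open import Level using (0ℓ)
open import Data.Nat using (ℕ; zero; suc; _<_) renaming (_≤_ to _≤ℕ_)
open import Data.Fin using (Fin)
open import Data.Maybe using (Maybe; just; nothing)
open import Data.Product using (Σ; ∃; _×_; _,_)
open import Data.Sum using (_⊎_)
open import Relation.Nullary using (¬_)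
open import Relation.Binary.PropositionalEquality using (_≡_; _≢_)
open import Algebra.Structures using (IsCommutativeRing)
open import Relation.Binary.Structures using (IsTotalOrder)

-- The real numbers, axiomatised as a complete ordered field
-- (unique up to isomorphism).  Equality is propositional.  The
-- inverse is total; its value at 0# is unconstrained and never used.

record RealNumbers : Set₁ where
  infixl 6 _+_
  infixl 7 _*_
  infix  4 _≤_
  field
    Carrier : Set
    _+_ _*_ : Carrier → Carrier → Carrier
    -_      : Carrier → Carrier
    0# 1#   : Carrier
    _⁻¹     : Carrier → Carrier
    _≤_     : Carrier → Carrier → Set
    isCommutativeRing : IsCommutativeRing _≡_ _+_ _*_ -_ 0# 1#
    0≢1       : 0# ≢ 1#
    ⁻¹-inverse : ∀ x → x ≢ 0# → x * (x ⁻¹) ≡ 1#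
    isTotalOrder : IsTotalOrder _≡_ _≤_
    +-mono-≤  : ∀ x y z → x ≤ y → x + z ≤ y + z
    *-nonneg  : ∀ x y → 0# ≤ x → 0# ≤ y → 0# ≤ x * y
    complete  : (S : Carrier → Set) → (∃ λ s → S s) →
                (∃ λ b → ∀ s → S s → s ≤ b) →
                ∃ λ u → (∀ s → S s → s ≤ u) ×
                        (∀ b → (∀ s → S s → s ≤ b) → u ≤ b)

module MaxAlgebra (ℝ : RealNumbers) where
  open RealNumbers ℝ

  Matrix : ℕ → Set
  Matrix n = Fin n → Fin n → Carrier

  Nonneg : ∀ {n} → Matrix n → Set
  Nonneg A = ∀ i j → 0# ≤ A i j

  prod : ℕ → (ℕ → Carrier) → Carrier
  prod zero    f = 1#
  prod (suc m) f = prod m f * f m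

  -- a strategy: τ i ≡ just j means i ∈ supp τ and τ(i) = j
  Strat : ℕ → Set
  Strat n = Fin n → Maybe (Fin n)

  InSupp : ∀ {n} → Strat n → Fin n → Set
  InSupp τ i = ∃ λ j → τ i ≡ just j

  IsStrategy : ∀ {n} → Matrix n → Strat n → Set
  IsStrategy A τ = ∀ i j → τ i ≡ just j → InSupp τ j × A i j ≢ 0#

  seqWeight : ∀ {n} → Matrix n → (ℕ → Fin n) → ℕ → Carrier
  seqWeight A u q = prod q (λ s → A (u s) (u (suc s)))

  Walk : ∀ {n} → Strat n → Fin n → Fin n → ℕ → (ℕ → Fin n) → Set
  Walk τ k i q u = u 0 ≡ k × u q ≡ i × (∀ s → s < q → τ (u s) ≡ just (u (suc s)))

  NRWalk : ∀ {n} → Strat n → Fin n → Fin n → ℕ → (ℕ → Fin n) → Set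
  NRWalk τ k i q u = Walk τ k i q u × (∀ s t → s ≤ℕ q → t ≤ℕ q → u s ≡ u t → s ≡ t)

  Reach : ∀ {n} → Strat n → Fin n → Fin n → Set
  Reach τ k i = k ≡ i ⊎ (∃ λ q → ∃ λ u → Walk τ k i q u)

  -- x = x^{(τ,k)}  (specified pointwise; it is uniquely determined since
  -- P^τ_{ki} is unique)
  IsX : ∀ {n} → Matrix n → Strat n → Fin n → (Fin n → Carrier) → Set
  IsX A τ k x =
    x k ≡ 1# ×
    (∀ i → i ≢ k → ∀ q u → NRWalk τ k i q u → x i ≡ (seqWeight A u q) ⁻¹) ×
    (∀ i → i ≢ k → ¬ Reach τ k i → x i ≡ 0#)

  CycleIn : ∀ {n} → Strat n → ℕ → (ℕ → Fin n) → Set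
  CycleIn τ p v =
    1 ≤ℕ p × v p ≡ v 0 ×
    (∀ s → s < p → τ (v s) ≡ just (v (suc s))) ×
    (∀ s t → s < p → t < p → v s ≡ v t → s ≡ t)

  -- τ is (the strategy identified with) a cycle of 𝒟(A)
  IsCycle : ∀ {n} → Matrix n → Strat n → ℕ → (ℕ → Fin n) → Set
  IsCycle A τ p v =
    IsStrategy A τ × CycleIn τ p v ×
    (∀ i → InSupp τ i → ∃ λ s → s < p × v s ≡ i)

  InC≥1 : ∀ {n} → Matrix n → Strat n → Set
  InC≥1 A τ = ∃ λ p → ∃ λ v → IsCycle A τ p v × 1# ≤ seqWeight A v p

  IsGerm : ∀ {n} → Matrix n → Strat n → ℕ → (ℕ → Fin n) → ℕ → (ℕ → Fin n) → Set
  IsGerm A τ p v q u =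
    IsStrategy A τ × CycleIn τ p v ×
    1 ≤ℕ q ×
    (∀ s → s < q → τ (u s) ≡ just (u (suc s))) ×
    (∀ s t → s ≤ℕ q → t ≤ℕ q → u s ≡ u t → s ≡ t) ×
    (∃ λ s → s < p × u q ≡ v s) ×
    (∀ s t → s < q → t < p → u s ≢ v t) ×
    (∀ i → InSupp τ i → (∃ λ s → s < p × v s ≡ i) ⊎ (∃ λ s → s < q × u s ≡ i))

  IsAdmGermFrom : ∀ {n} → Matrix n → Strat n → Fin n → Set
  IsAdmGermFrom A τ o =
    ∃ λ p → ∃ λ v → ∃ λ q → ∃ λ u →
      IsGerm A τ p v q u × u 0 ≡ o × 1# ≤ seqWeight A v p

  LeAt : ∀ {n} → Fin n → (Fin n → Carrier) → (Fin n → Carrier) → Set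
  LeAt i y x = x i ≢ 0# × y i ≢ 0# × (∀ l → y l * (y i) ⁻¹ ≤ x l * (x i) ⁻¹)

-- Idea.  𝒟(A^τ) is a functional graph, so every walk from k follows the
-- orbit k, τ k, τ² k, … .  Under either hypothesis this orbit is a lasso:
-- after a tail it runs around a cycle of weight ≥ 1, and every node of
-- supp τ lies on it.  Hence x^{(τ,c)}_l is the inverse weight of the orbit
-- segment from c to its first visit of l (or 0 if l is never visited).
-- For i first visited at step M and l first visited d steps after i, the
-- segment k → i → l differs from the first-visit segment k → l by a closed
-- walk, which winds around the cycle and so weighs ≥ 1; this is exactly
-- x^{(τ,i)}_l · (x^{(τ,i)}_i)⁻¹ ≤ x^{(τ,k)}_l · (x^{(τ,k)}_i)⁻¹.
module Submission where

open import Defs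
open import Level using (0ℓ)
open import Data.Nat using (ℕ; zero; suc; _+_; _*_; _∸_; _<_; _<?_; z≤n; z<s; NonZero; >-nonZero)
  renaming (_≤_ to _≤ℕ_)
open import Data.Nat.Properties
  using (m∸n+n≡m; m+[n∸m]≡n; ≮⇒≥; <-cmp; <⇒≤; <⇒≢; m<1+n⇒m<n∨m≡n; m≤m*n; m≤m+n; m<m+n;
         n≤1+n; n<1+n; ≤-pred; +-assoc; +-comm; +-identityʳ; +-monoʳ-<)
  renaming (≤-refl to ≤ℕ-refl; ≤-trans to ≤ℕ-trans; ≤-reflexive to ≤ℕ-reflexive)
open import Data.Nat.DivMod using (_%_; _/_; m≡m%n+[m/n]*n; m%n<n)
open import Data.Nat.Induction using (<-rec)
open import Data.Nat.Tactic.RingSolver using (solve-∀)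
open import Data.Fin using (Fin) renaming (_≟_ to _≟ᶠ_)
open import Data.Maybe using (just; fromMaybe)
open import Data.Product using (∃; _×_; _,_; proj₁; proj₂)
open import Data.Sum using (_⊎_; inj₁; inj₂)
open import Data.Empty using (⊥; ⊥-elim)
open import Relation.Nullary using (¬_; yes; no)
open import Relation.Unary using (Decidable)
open import Relation.Binary.Definitions using (DecidableEquality; tri<; tri≈; tri>)
open import Relation.Binary.PropositionalEquality
open import Algebra.Bundles using (CommutativeRing)
open import Relation.Binary.Structures using (IsTotalOrder)
open ≡-Reasoning

module OrderedFieldFacts (ℝ : RealNumbers) where
  open RealNumbers ℝ renaming (_+_ to _+ᴿ_; _*_ to _·_)
  open MaxAlgebra ℝ using (prod)
  private
    ring′ : CommutativeRing 0ℓ 0ℓ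
    ring′ = record { isCommutativeRing = isCommutativeRing }
    module R = CommutativeRing ring′
  open R public using (*-assoc; *-comm; *-identityˡ; *-identityʳ)
  open R using (zeroʳ; -‿inverseˡ; -‿inverseʳ; +-identityˡ; distribʳ)
  open import Algebra.Properties.Ring R.ring using (-‿distribʳ-*; -1*x≈-x; -‿involutive)
  module ≤ = IsTotalOrder isTotalOrder

  ≤-refl : ∀ {x} → x ≤ x
  ≤-refl = ≤.reflexive refl

  ≤-trans : ∀ {x y z} → x ≤ y → y ≤ z → x ≤ z
  ≤-trans = ≤.trans

  1≢0 : 1# ≢ 0#
  1≢0 e = 0≢1 (sym e)

  ≤⇒diff-nonneg : ∀ {x y} → x ≤ y → 0# ≤ y +ᴿ - x
  ≤⇒diff-nonneg {x} {y} x≤y = subst (_≤ y +ᴿ - x) (-‿inverseʳ x) (+-mono-≤ x y (- x) x≤y)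

  diff-nonneg⇒≤ : ∀ {x y} → 0# ≤ y +ᴿ - x → x ≤ y
  diff-nonneg⇒≤ {x} {y} h = subst₂ _≤_ (+-identityˡ x) cancel (+-mono-≤ 0# (y +ᴿ - x) x h)
    where
    cancel : y +ᴿ - x +ᴿ x ≡ y
    cancel = trans (R.+-assoc y (- x) x) (trans (cong (y +ᴿ_) (-‿inverseˡ x)) (R.+-identityʳ y))

  ≤0⇒neg-nonneg : ∀ {x} → x ≤ 0# → 0# ≤ - x
  ≤0⇒neg-nonneg h = subst (0# ≤_) (+-identityˡ _) (≤⇒diff-nonneg h)

  0≤1 : 0# ≤ 1#
  0≤1 with ≤.total 0# 1#
  ... | inj₁ 0≤1 = 0≤1
  ... | inj₂ 1≤0 = subst (0# ≤_) square (*-nonneg _ _ neg neg)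
    where
    neg : 0# ≤ - 1#
    neg = ≤0⇒neg-nonneg 1≤0
    square : - 1# · - 1# ≡ 1#
    square = trans (-1*x≈-x (- 1#)) (-‿involutive 1#)

  *-cancelˡ : ∀ {x a b} → x ≢ 0# → x · a ≡ x · b → a ≡ b
  *-cancelˡ {x} {a} {b} x≢0 e = begin
    a                ≡⟨ sym (*-identityˡ a) ⟩
    1# · a           ≡⟨ cong (_· a) (sym left-inverse) ⟩
    (x ⁻¹ · x) · a   ≡⟨ *-assoc _ _ _ ⟩
    x ⁻¹ · (x · a)   ≡⟨ cong (x ⁻¹ ·_) e ⟩
    x ⁻¹ · (x · b)   ≡⟨ sym (*-assoc _ _ _) ⟩
    (x ⁻¹ · x) · b   ≡⟨ cong (_· b) left-inverse ⟩
    1# · b           ≡⟨ *-identityˡ b ⟩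
    b                ∎
    where
    left-inverse : x ⁻¹ · x ≡ 1#
    left-inverse = trans (*-comm _ _) (⁻¹-inverse x x≢0)

  *-≢0 : ∀ {x y} → x ≢ 0# → y ≢ 0# → x · y ≢ 0#
  *-≢0 {x} x≢0 y≢0 e = y≢0 (*-cancelˡ x≢0 (trans e (sym (zeroʳ x))))

  1⁻¹≡1 : 1# ⁻¹ ≡ 1#
  1⁻¹≡1 = trans (sym (*-identityˡ _)) (⁻¹-inverse 1# 1≢0)

  ⁻¹-≢0 : ∀ {x} → x ≢ 0# → x ⁻¹ ≢ 0#
  ⁻¹-≢0 {x} x≢0 e = 0≢1 (trans (sym (zeroʳ x)) (trans (cong (x ·_) (sym e)) (⁻¹-inverse x x≢0)))

  ⁻¹-involutive : ∀ {x} → x ≢ 0# → (x ⁻¹) ⁻¹ ≡ x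
  ⁻¹-involutive {x} x≢0 = *-cancelˡ (⁻¹-≢0 x≢0)
    (trans (⁻¹-inverse _ (⁻¹-≢0 x≢0)) (sym (trans (*-comm _ _) (⁻¹-inverse x x≢0))))

  -- A nonzero x ≥ 0 has x⁻¹ ≥ 0: otherwise 0 ≤ x · (- x⁻¹) = -1.
  ⁻¹-nonneg : ∀ {x} → 0# ≤ x → x ≢ 0# → 0# ≤ x ⁻¹
  ⁻¹-nonneg {x} 0≤x x≢0 with ≤.total 0# (x ⁻¹)
  ... | inj₁ h = h
  ... | inj₂ h = ⊥-elim (1≢0 (≤.antisym (diff-nonneg⇒≤ (subst (0# ≤_) minus-one positive)) 0≤1))
    where
    positive : 0# ≤ x · - (x ⁻¹)
    positive = *-nonneg x _ 0≤x (≤0⇒neg-nonneg h)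
    minus-one : x · - (x ⁻¹) ≡ 0# +ᴿ - 1#
    minus-one = trans (sym (-‿distribʳ-* x (x ⁻¹)))
                      (trans (cong -_ (⁻¹-inverse x x≢0)) (sym (+-identityˡ _)))

  ≤-scale : ∀ {z R} → 0# ≤ z → 1# ≤ R → z ≤ R · z
  ≤-scale {z} {R} 0≤z 1≤R = diff-nonneg⇒≤ (subst (0# ≤_) expand (*-nonneg _ _ (≤⇒diff-nonneg 1≤R) 0≤z))
    where
    expand : (R +ᴿ - 1#) · z ≡ R · z +ᴿ - z
    expand = trans (distribʳ z R (- 1#)) (cong (R · z +ᴿ_) (-1*x≈-x z))

  ≥1-* : ∀ {a b} → 1# ≤ a → 1# ≤ b → 1# ≤ a · b
  ≥1-* {a} {b} 1≤a 1≤b = ≤-trans 1≤a (subst (a ≤_) (*-comm b a) (≤-scale (≤-trans 0≤1 1≤a) 1≤b))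

  ⁻¹-≤-regroup : ∀ {P Q S R} → 0# ≤ Q → Q ≢ 0# → S ≢ 0# → 1# ≤ R →
                 P · Q ≡ S · R → Q ⁻¹ ≤ S ⁻¹ · P
  ⁻¹-≤-regroup {P} {Q} {S} {R} 0≤Q Q≢0 S≢0 1≤R PQ≡SR =
    subst (Q ⁻¹ ≤_) regroup (≤-scale (⁻¹-nonneg 0≤Q Q≢0) 1≤R)
    where
    regroup : R · Q ⁻¹ ≡ S ⁻¹ · P
    regroup = begin
      R · Q ⁻¹                  ≡⟨ sym (*-identityˡ _) ⟩
      1# · (R · Q ⁻¹)           ≡⟨ cong (_· (R · Q ⁻¹)) (sym (trans (*-comm _ _) (⁻¹-inverse S S≢0))) ⟩
      (S ⁻¹ · S) · (R · Q ⁻¹)   ≡⟨ *-assoc _ _ _ ⟩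
      S ⁻¹ · (S · (R · Q ⁻¹))   ≡⟨ cong (S ⁻¹ ·_) (sym (*-assoc S R _)) ⟩
      S ⁻¹ · ((S · R) · Q ⁻¹)   ≡⟨ cong (λ w → S ⁻¹ · (w · Q ⁻¹)) (sym PQ≡SR) ⟩
      S ⁻¹ · ((P · Q) · Q ⁻¹)   ≡⟨ cong (S ⁻¹ ·_) (*-assoc P Q _) ⟩
      S ⁻¹ · (P · (Q · Q ⁻¹))   ≡⟨ cong (λ w → S ⁻¹ · (P · w)) (⁻¹-inverse Q Q≢0) ⟩
      S ⁻¹ · (P · 1#)           ≡⟨ cong (S ⁻¹ ·_) (*-identityʳ P) ⟩
      S ⁻¹ · P                  ∎

  prod-cong : ∀ m {f g} → (∀ s → s < m → f s ≡ g s) → prod m f ≡ prod m g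
  prod-cong zero    f≗g = refl
  prod-cong (suc m) f≗g =
    cong₂ _·_ (prod-cong m (λ s s<m → f≗g s (≤ℕ-trans s<m (n≤1+n _)))) (f≗g m (n<1+n m))

  prod-split : ∀ m₂ m₁ f → prod (m₂ + m₁) f ≡ prod m₁ f · prod m₂ (λ s → f (s + m₁))
  prod-split zero     m₁ f = sym (*-identityʳ _)
  prod-split (suc m₂) m₁ f = trans (cong (_· f (m₂ + m₁)) (prod-split m₂ m₁ f)) (*-assoc _ _ _)

least-below : {P : ℕ → Set} → Decidable P → ∀ N →
  (∃ λ d → d < N × P d × (∀ d′ → d′ < d → ¬ P d′)) ⊎ (∀ d → d < N → ¬ P d)
least-below P? zero = inj₂ (λ d ())
least-below {P} P? (suc N) with least-below P? N
... | inj₁ (d , d<N , Pd , least) = inj₁ (d , ≤ℕ-trans d<N (n≤1+n N) , Pd , least)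
... | inj₂ none with P? N
...   | yes PN = inj₁ (N , n<1+n N , PN , none)
...   | no ¬PN = inj₂ below
  where
  below : ∀ d → d < suc N → ¬ P d
  below d d<1+N with m<1+n⇒m<n∨m≡n d<1+N
  ... | inj₁ d<N = none d d<N
  ... | inj₂ refl = ¬PN

-- The orbit x₀, f x₀, f² x₀, … of a self-map f of a set with decidable
-- equality, and its periodicity.  Positions are written "s + c": s steps
-- after position c.
module Orbit {X : Set} (f : X → X) (x₀ : X) (_≟_ : DecidableEquality X) where

  orb : ℕ → X
  orb zero    = x₀
  orb (suc s) = f (orb s)

  shift : ∀ d {s t} → orb s ≡ orb t → orb (d + s) ≡ orb (d + t)
  shift zero    e = e
  shift (suc d) e = cong f (shift d e)

  record Period (L c : ℕ) : Set where
    constructor period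
    field loop : orb (L + c) ≡ orb c
  open Period public

  period-shift : ∀ {L c} → Period L c → ∀ d → Period L (d + c)
  period-shift {L} {c} (period h) d = period (trans (cong orb (swap L d c)) (shift d h))
    where
    swap : ∀ a b c → a + (b + c) ≡ b + (a + c)
    swap = solve-∀

  period-mono : ∀ {L c c′} → Period L c → c ≤ℕ c′ → Period L c′
  period-mono {L} {c} {c′} h c≤c′ = subst (Period L) (m∸n+n≡m c≤c′) (period-shift h (c′ ∸ c))

  period-mult : ∀ {L c} → Period L c → ∀ j → Period (j * L) c
  period-mult h zero = period refl
  period-mult {L} {c} h (suc j) = period (trans (cong orb (+-assoc L (j * L) c))
    (trans (loop (period-shift h (j * L))) (loop (period-mult h j))))

  -- A period valid somewhere is valid at any position of a periodic orbit:
  -- walk far ahead to a position a·M + b that is equivalent to b.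
  period-transfer : ∀ {L a M b} → Period L a → Period M b → 0 < M → Period L b
  period-transfer {L} {a} {M} {b} hL hM 0<M = period (begin
    orb (L + b)  ≡⟨ shift L (sym back) ⟩
    orb (L + c)  ≡⟨ loop (period-mono hL a≤c) ⟩
    orb c        ≡⟨ back ⟩
    orb b        ∎)
    where
    c : ℕ
    c = a * M + b
    back : orb c ≡ orb b
    back = loop (period-mult hM a)
    a≤c : a ≤ℕ c
    a≤c = ≤ℕ-trans (m≤m*n a M {{>-nonZero 0<M}}) (m≤m+n _ b)

  FirstHit : ℕ → X → ℕ → Set
  FirstHit c l d = orb (d + c) ≡ l × (∀ d′ → d′ < d → orb (d′ + c) ≢ l)

  first-hit-self : ∀ {c d} → FirstHit c (orb c) d → d ≡ 0
  first-hit-self {d = zero}  _            = refl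
  first-hit-self {d = suc _} (_ , before) = ⊥-elim (before 0 z<s refl)

  first-hit : ∀ c l q → orb (q + c) ≡ l → ∃ λ d → FirstHit c l d × d ≤ℕ q
  first-hit c l q hit with least-below (λ s → orb (s + c) ≟ l) (suc q)
  ... | inj₁ (d , d<1+q , hd , before) = d , (hd , before) , ≤-pred d<1+q
  ... | inj₂ none = ⊥-elim (none q (n<1+n q) hit)

  -- A repetition orb (s + c) = orb (t + c) with s < t ≤ d would let the
  -- orbit reach l already at step d − (t − s) < d.
  first-hit-no-repeat : ∀ {c l d s t} → FirstHit c l d → s < t → t ≤ℕ d →
    orb (s + c) ≢ orb (t + c)
  first-hit-no-repeat {c} {l} {d} {s} {t} (hit , before) s<t t≤d e = before (E + s) earlier reaches
    where
    E : ℕ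
    E = d ∸ t
    earlier : E + s < d
    earlier = subst (E + s <_) (m∸n+n≡m t≤d) (+-monoʳ-< E s<t)
    reaches : orb (E + s + c) ≡ l
    reaches = begin
      orb (E + s + c)    ≡⟨ cong orb (+-assoc E s c) ⟩
      orb (E + (s + c))  ≡⟨ shift E e ⟩
      orb (E + (t + c))  ≡⟨ cong orb (sym (+-assoc E t c)) ⟩
      orb (E + t + c)    ≡⟨ cong (λ m → orb (m + c)) (m∸n+n≡m t≤d) ⟩
      orb (d + c)        ≡⟨ hit ⟩
      l                  ∎

  first-hit-injective : ∀ {c l d} → FirstHit c l d →
    ∀ s t → s ≤ℕ d → t ≤ℕ d → orb (s + c) ≡ orb (t + c) → s ≡ t
  first-hit-injective fh s t s≤d t≤d e with <-cmp s t
  ... | tri< s<t _ _ = ⊥-elim (first-hit-no-repeat fh s<t t≤d e)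
  ... | tri≈ _ s≡t _ = s≡t
  ... | tri> _ _ t<s = ⊥-elim (first-hit-no-repeat fh t<s s≤d (sym e))

  module Lasso (p b₀ : ℕ) (0<p : 0 < p) (cycle-period : Period p b₀)
      (cycle-distinct : ∀ s t → s < p → t < p → orb (s + b₀) ≡ orb (t + b₀) → s ≡ t) where

    no-short-period : ∀ {L a} → 0 < L → L < p → Period L a → ⊥
    no-short-period 0<L L<p h =
      <⇒≢ 0<L (sym (cycle-distinct _ 0 L<p 0<p (loop (period-transfer h cycle-period 0<p))))

    period-everywhere : ∀ {L a} → 0 < L → Period L a → Period p a
    period-everywhere 0<L h = period-transfer cycle-period h 0<L

    early-visit : ∀ c q → ∃ λ q′ → q′ < b₀ + p × orb (q′ + c) ≡ orb (q + c)
    early-visit c q with q <? b₀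
    ... | yes q<b₀ = q , ≤ℕ-trans q<b₀ (m≤m+n b₀ p) , refl
    ... | no q≮b₀ = b₀ + r , +-monoʳ-< b₀ (m%n<n t p) , sym back
      where
      instance
        p≢0 : NonZero p
        p≢0 = >-nonZero 0<p
      t r j : ℕ
      t = q ∸ b₀
      r = t % p
      j = t / p
      rearrange : ∀ b r m c → b + (r + m) + c ≡ m + (b + r + c)
      rearrange = solve-∀
      back : orb (q + c) ≡ orb (b₀ + r + c)
      back = begin
        orb (q + c)                   ≡⟨ cong (λ m → orb (m + c)) (sym (m+[n∸m]≡n (≮⇒≥ q≮b₀))) ⟩
        orb (b₀ + t + c)              ≡⟨ cong (λ m → orb (b₀ + m + c)) (m≡m%n+[m/n]*n t p) ⟩
        orb (b₀ + (r + j * p) + c)    ≡⟨ cong orb (rearrange b₀ r (j * p) c) ⟩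
        orb (j * p + (b₀ + r + c))    ≡⟨ loop (period-mono (period-mult cycle-period j)
                                           (≤ℕ-trans (m≤m+n b₀ r) (m≤m+n _ c))) ⟩
        orb (b₀ + r + c)              ∎

    hit-or-miss : ∀ c l → (∃ λ d → FirstHit c l d) ⊎ (∀ q → orb (q + c) ≢ l)
    hit-or-miss c l with least-below (λ s → orb (s + c) ≟ l) (b₀ + p)
    ... | inj₁ (d , _ , hit , before) = inj₁ (d , hit , before)
    ... | inj₂ none = inj₂ missed
      where
      missed : ∀ q → orb (q + c) ≢ l
      missed q hit with early-visit c q
      ... | q′ , q′<bound , same = none q′ q′<bound (trans same hit)

module StrategyOrbit (ℝ : RealNumbers) {n : ℕ} (A : MaxAlgebra.Matrix ℝ n)
    (τ : MaxAlgebra.Strat ℝ n) (k : Fin n) where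
  open RealNumbers ℝ hiding (_+_) renaming (_*_ to _·_)
  open MaxAlgebra ℝ
  open OrderedFieldFacts ℝ

  -- the successor of j in 𝒟(A^τ); nodes outside supp τ are left fixed,
  -- which is never observed below
  next : Fin n → Fin n
  next j = fromMaybe j (τ j)

  next-≡ : ∀ {j j′} → τ j ≡ just j′ → next j ≡ j′
  next-≡ {j} e = cong (fromMaybe j) e

  open Orbit next k _≟ᶠ_ public

  -- 𝒟(A^τ) has out-degree ≤ 1, so a walk that meets the orbit follows it
  walk-on-orbit : ∀ (u : ℕ → Fin n) q j c → (∀ s → s < q → τ (u s) ≡ just (u (suc s))) →
    u j ≡ orb c → ∀ d → d + j ≤ℕ q → u (d + j) ≡ orb (d + c)
  walk-on-orbit u q j c steps start zero    _    = start
  walk-on-orbit u q j c steps start (suc d) d<q = trans (sym (next-≡ (steps (d + j) d<q)))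
    (cong next (walk-on-orbit u q j c steps start d (≤ℕ-trans (n≤1+n _) d<q)))

  walk-from-orbit : ∀ (u : ℕ → Fin n) q c → (∀ s → s < q → τ (u s) ≡ just (u (suc s))) →
    u 0 ≡ orb c → ∀ t → t ≤ℕ q → u t ≡ orb (t + c)
  walk-from-orbit u q c steps start t t≤q = subst (λ m → u m ≡ orb (t + c)) (+-identityʳ t)
    (walk-on-orbit u q 0 c steps start t (subst (_≤ℕ q) (sym (+-identityʳ t)) t≤q))

  cycle-on-orbit : ∀ {p v j₀ a} → CycleIn τ p v → j₀ < p → v j₀ ≡ orb a →
    ∃ λ b₀ → ∀ t → t ≤ℕ p → v t ≡ orb (t + b₀)
  cycle-on-orbit {p} {v} {j₀} {a} (_ , closes , steps , _) j₀<p v↦a =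
    p ∸ j₀ + a , walk-from-orbit v p _ steps start
    where
    around : p ∸ j₀ + j₀ ≡ p
    around = m∸n+n≡m (<⇒≤ j₀<p)
    start : v 0 ≡ orb (p ∸ j₀ + a)
    start = begin
      v 0               ≡⟨ sym closes ⟩
      v p               ≡⟨ cong v (sym around) ⟩
      v (p ∸ j₀ + j₀)   ≡⟨ walk-on-orbit v p j₀ a steps v↦a (p ∸ j₀) (≤ℕ-reflexive around) ⟩
      orb (p ∸ j₀ + a)  ∎

  W : ℕ → ℕ → Carrier
  W c d = seqWeight A (λ s → orb (s + c)) d

  W-split : ∀ c d₂ d₁ → W c (d₂ + d₁) ≡ W c d₁ · W (d₁ + c) d₂
  W-split c d₂ d₁ = trans (prod-split d₂ d₁ _) (cong (W c d₁ ·_)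
    (prod-cong d₂ (λ s _ → cong (λ m → A (orb m) (orb (suc m))) (+-assoc s d₁ c))))

  x-unreachable : ∀ {c z l} → IsX A τ (orb c) z → (∀ q → orb (q + c) ≢ l) → z l ≡ 0#
  x-unreachable {c} {z} {l} (_ , _ , z-zero) missed =
    z-zero l (λ l≡c → missed 0 (sym l≡c)) unreachable
    where
    unreachable : ¬ Reach τ (orb c) l
    unreachable (inj₁ c≡l) = missed 0 c≡l
    unreachable (inj₂ (q , u , u↦c , u↦l , steps)) =
      missed q (trans (sym (walk-from-orbit u q c steps u↦c q ≤ℕ-refl)) u↦l)

  module OnSupport (nonneg : Nonneg A) (strat : IsStrategy A τ)
      (on-support : ∀ s → τ (orb s) ≡ just (orb (suc s))) where

    W-nonneg : ∀ c d → 0# ≤ W c d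
    W-nonneg c zero    = 0≤1
    W-nonneg c (suc d) = *-nonneg _ _ (W-nonneg c d) (nonneg _ _)

    W-≢0 : ∀ c d → W c d ≢ 0#
    W-≢0 c zero    = 1≢0
    W-≢0 c (suc d) = *-≢0 (W-≢0 c d) (proj₂ (strat _ _ (on-support (d + c))))

    -- the orbit segment up to the first visit of l is the path P^τ from orb c to l
    first-hit-path : ∀ {c l d} → FirstHit c l d → NRWalk τ (orb c) l d (λ s → orb (s + c))
    first-hit-path {c} fh@(hit , _) = (refl , hit , λ s _ → on-support (s + c)) , first-hit-injective fh

    x-at-first-hit : ∀ {c z l d} → IsX A τ (orb c) z → FirstHit c l d → z l ≡ (W c d) ⁻¹
    x-at-first-hit {c} {z} {l} {d} (z-self , z-path , _) fh with l ≟ᶠ orb c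
    ... | no l≢c = z-path l l≢c d _ (first-hit-path fh)
    ... | yes refl rewrite first-hit-self fh = trans z-self (sym 1⁻¹≡1)

    module WeightedLasso (p b₀ : ℕ) (0<p : 0 < p) (cycle-period : Period p b₀)
        (cycle-distinct : ∀ s t → s < p → t < p → orb (s + b₀) ≡ orb (t + b₀) → s ≡ t)
        (cycle-weight : 1# ≤ W b₀ p) where
      open Lasso p b₀ 0<p cycle-period cycle-distinct

      rotate : ∀ {a} → Period p a → W a p ≡ W (suc a) p
      rotate {a} (period back) = *-cancelˡ (proj₂ (strat _ _ (on-support a))) (begin
        e a · W a p               ≡⟨ *-comm _ _ ⟩
        W a p · e a               ≡⟨ cong (W a p ·_) (sym same-edge) ⟩
        W a (suc p)               ≡⟨ cong (W a) (+-comm 1 p) ⟩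
        W a (p + 1)               ≡⟨ W-split a p 1 ⟩
        (1# · e a) · W (suc a) p  ≡⟨ cong (_· W (suc a) p) (*-identityˡ (e a)) ⟩
        e a · W (suc a) p         ∎)
        where
        e : ℕ → Carrier
        e s = A (orb s) (orb (suc s))
        same-edge : e (p + a) ≡ e a
        same-edge = cong₂ A back (cong next back)

      period-weight : ∀ {a} → Period p a → 1# ≤ W a p
      period-weight {a} h = subst (1# ≤_) (begin
        W b₀ p         ≡⟨ rotate-many cycle-period a ⟩
        W (a + b₀) p   ≡⟨ cong (λ c → W c p) (+-comm a b₀) ⟩
        W (b₀ + a) p   ≡⟨ sym (rotate-many h b₀) ⟩
        W a p          ∎) cycle-weight
        where
        rotate-many : ∀ {c} → Period p c → ∀ t → W c p ≡ W (t + c) p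
        rotate-many h zero    = refl
        rotate-many h (suc t) = trans (rotate-many h t) (rotate (period-shift h t))

      -- Every closed walk on the orbit weighs ≥ 1: it winds around the
      -- cycle some number of times (induction on its length in steps of p).
      closed-walk-weight : ∀ L a → Period L a → 1# ≤ W a L
      closed-walk-weight = <-rec (λ L → ∀ a → Period L a → 1# ≤ W a L) closed
        where
        closed : ∀ L → (∀ {L′} → L′ < L → ∀ a → Period L′ a → 1# ≤ W a L′) →
                 ∀ a → Period L a → 1# ≤ W a L
        closed zero _ a _ = ≤-refl
        closed L@(suc _) shorter a h with L <? p
        ... | yes L<p = ⊥-elim (no-short-period z<s L<p h)
        ... | no L≮p = subst (1# ≤_) (trans (sym (W-split a L′ p)) (cong (W a) around))
            (≥1-* (period-weight hp) (shorter L′<L (p + a) rest))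
          where
          L′ : ℕ
          L′ = L ∸ p
          around : L′ + p ≡ L
          around = m∸n+n≡m (≮⇒≥ L≮p)
          L′<L : L′ < L
          L′<L = subst (L′ <_) around (m<m+n L′ 0<p)
          hp : Period p a
          hp = period-everywhere z<s h
          rest : Period L′ (p + a)
          rest = period (begin
            orb (L′ + (p + a))  ≡⟨ cong orb (sym (+-assoc L′ p a)) ⟩
            orb (L′ + p + a)    ≡⟨ cong (λ m → orb (m + a)) around ⟩
            orb (L + a)         ≡⟨ loop h ⟩
            orb a               ≡⟨ sym (loop hp) ⟩
            orb (p + a)         ∎)

      x-nonneg : ∀ {c z} → IsX A τ (orb c) z → ∀ l → 0# ≤ z l
      x-nonneg {c} X l with hit-or-miss c l
      ... | inj₁ (d , fh) = subst (0# ≤_) (sym (x-at-first-hit X fh)) (⁻¹-nonneg (W-nonneg c d) (W-≢0 c d))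
      ... | inj₂ missed = subst (0# ≤_) (sym (x-unreachable X missed)) ≤-refl

      -- If l is first visited d steps after position M + c, then the segment
      -- c → M + c → l and the first-visit segment c → l differ by a closed
      -- walk; hence y_l ≤ x_l · W c M.
      reached-≤ : ∀ {c M l d x y} → IsX A τ (orb c) x → IsX A τ (orb (M + c)) y →
        FirstHit (M + c) l d → y l ≤ x l · W c M
      reached-≤ {c} {M} {l} {d} {x} {y} X Y fh-l@(l-hit , _)
        with first-hit c l (d + M) (trans (cong orb (+-assoc d M c)) l-hit)
      ... | a , fh-a@(a-hit , _) , a≤ = subst₂ _≤_ (sym (x-at-first-hit Y fh-l))
          (cong (_· W c M) (sym (x-at-first-hit X fh-a)))
          (⁻¹-≤-regroup (W-nonneg (M + c) d) (W-≢0 (M + c) d) (W-≢0 c a)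
            (closed-walk-weight r (a + c) closed) regroup)
        where
        r : ℕ
        r = d + M ∸ a
        around : r + a ≡ d + M
        around = m∸n+n≡m a≤
        closed : Period r (a + c)
        closed = period (begin
          orb (r + (a + c))  ≡⟨ cong orb (sym (+-assoc r a c)) ⟩
          orb (r + a + c)    ≡⟨ cong (λ m → orb (m + c)) around ⟩
          orb (d + M + c)    ≡⟨ cong orb (+-assoc d M c) ⟩
          orb (d + (M + c))  ≡⟨ l-hit ⟩
          l                  ≡⟨ sym a-hit ⟩
          orb (a + c)        ∎)
        regroup : W c M · W (M + c) d ≡ W c a · W (a + c) r
        regroup = begin
          W c M · W (M + c) d  ≡⟨ sym (W-split c d M) ⟩
          W c (d + M)          ≡⟨ cong (W c) (sym around) ⟩
          W c (r + a)          ≡⟨ W-split c r a ⟩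
          W c a · W (a + c) r  ∎

      first-hit-≤ : ∀ {c i M x y} → FirstHit c i M → IsX A τ (orb c) x → IsX A τ i y →
        LeAt i y x
      first-hit-≤ {c} {i} {M} {x} {y} fh@(i-hit , _) X Y@(y-self , _) =
        x-i≢0 , y-i≢0 , ratio
        where
        x-i : x i ≡ (W c M) ⁻¹
        x-i = x-at-first-hit X fh
        x-i≢0 : x i ≢ 0#
        x-i≢0 e = ⁻¹-≢0 (W-≢0 c M) (trans (sym x-i) e)
        y-i≢0 : y i ≢ 0#
        y-i≢0 e = 1≢0 (trans (sym y-self) e)
        Y′ : IsX A τ (orb (M + c)) y
        Y′ = subst (λ j → IsX A τ j y) (sym i-hit) Y
        bound : ∀ l → y l ≤ x l · W c M
        bound l with hit-or-miss (M + c) l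
        ... | inj₁ (d , fh-l) = reached-≤ {c} {M} X Y′ fh-l
        ... | inj₂ missed = subst (_≤ x l · W c M) (sym (x-unreachable Y′ missed))
            (*-nonneg _ _ (x-nonneg {c} X l) (W-nonneg c M))
        ratio : ∀ l → y l · (y i) ⁻¹ ≤ x l · (x i) ⁻¹
        ratio l = subst₂ _≤_ (sym y-scaled) (sym x-scaled) (bound l)
          where
          y-scaled : y l · (y i) ⁻¹ ≡ y l
          y-scaled = begin
            y l · (y i) ⁻¹  ≡⟨ cong (λ w → y l · w ⁻¹) y-self ⟩
            y l · 1# ⁻¹     ≡⟨ cong (y l ·_) 1⁻¹≡1 ⟩
            y l · 1#        ≡⟨ *-identityʳ (y l) ⟩
            y l             ∎
          x-scaled : x l · (x i) ⁻¹ ≡ x l · W c M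
          x-scaled = cong (x l ·_) (trans (cong _⁻¹ x-i) (⁻¹-involutive (W-≢0 c M)))

  lasso-≤ : Nonneg A → IsStrategy A τ → InSupp τ k →
    ∀ {p v b₀} → CycleIn τ p v → 1# ≤ seqWeight A v p → (∀ t → t ≤ℕ p → v t ≡ orb (t + b₀)) →
    ∀ {i} m → orb m ≡ i → ∀ {x y} → IsX A τ k x → IsX A τ i y → LeAt i y x
  lasso-≤ nonneg strat k∈τ {p} {v} {b₀} (0<p , closes , _ , distinct) weight on-cycle m m↦i =
    first-hit-≤ {0} (proj₁ (proj₂ (first-hit 0 _ m (trans (cong orb (+-identityʳ m)) m↦i))))
    where
    step-in-support : ∀ {j} → InSupp τ j → τ j ≡ just (next j)
    step-in-support (_ , τj≡j′) = trans τj≡j′ (cong just (sym (next-≡ τj≡j′)))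
    -- supp τ is closed under τ, so the whole orbit of k lies in it
    in-support : ∀ s → InSupp τ (orb s)
    in-support zero    = k∈τ
    in-support (suc s) = proj₁ (strat _ _ (step-in-support (in-support s)))
    open OnSupport nonneg strat (λ s → step-in-support (in-support s))
    cycle-period : Period p b₀
    cycle-period = period (trans (sym (on-cycle p ≤ℕ-refl)) (trans closes (on-cycle 0 z≤n)))
    cycle-distinct : ∀ s t → s < p → t < p → orb (s + b₀) ≡ orb (t + b₀) → s ≡ t
    cycle-distinct s t s<p t<p e = distinct s t s<p t<p
      (trans (on-cycle s (<⇒≤ s<p)) (trans e (sym (on-cycle t (<⇒≤ t<p)))))
    cycle-weight : 1# ≤ W b₀ p
    cycle-weight = subst (1# ≤_)
      (prod-cong p (λ s s<p → cong₂ A (on-cycle s (<⇒≤ s<p)) (on-cycle (suc s) s<p))) weight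
    open WeightedLasso p b₀ 0<p cycle-period cycle-distinct cycle-weight

open RealNumbers using (Carrier)
open MaxAlgebra

-- Both hypotheses put k ∈ supp τ and a cycle of weight ≥ 1 on the orbit of k,
-- and every i ∈ supp τ lies on the cycle or on the germ's walk from k.
corollary3p3 : (ℝ : RealNumbers) (n : ℕ) (A : Matrix ℝ n) → Nonneg ℝ A →
    (τ : Strat ℝ n) (k : Fin n) →
    (IsAdmGermFrom ℝ A τ k ⊎ (InC≥1 ℝ A τ × InSupp ℝ τ k)) →
    (i : Fin n) → InSupp ℝ τ i → i ≢ k →
    (x y : Fin n → Carrier ℝ) → IsX ℝ A τ k x → IsX ℝ A τ i y →
    LeAt ℝ i y x
corollary3p3 ℝ n A nonneg τ k hyp i i∈τ _ x y X Y = conclude hyp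
  where
  open StrategyOrbit ℝ A τ k
  conclude : IsAdmGermFrom ℝ A τ k ⊎ (InC≥1 ℝ A τ × InSupp ℝ τ k) → LeAt ℝ i y x
  conclude (inj₂ ((p , v , (strat , cycle , covers) , weight) , k∈τ))
    with covers k k∈τ | covers i i∈τ
  ... | j₀ , j₀<p , v↦k | j₁ , j₁<p , v↦i with cycle-on-orbit {a = 0} cycle j₀<p v↦k
  ...   | b₀ , on-cycle = lasso-≤ nonneg strat k∈τ cycle weight on-cycle (j₁ + b₀)
          (trans (sym (on-cycle j₁ (<⇒≤ j₁<p))) v↦i) X Y
  conclude (inj₁ (p , v , q , u , (strat , cycle , 0<q , u-steps , _ , (j₀ , j₀<p , u↦v) , _ , covers) ,
                  u↦k , weight)) = node (covers i i∈τ)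
    where
    on-walk : ∀ t → t ≤ℕ q → u t ≡ orb (t + 0)
    on-walk = walk-from-orbit u q 0 u-steps u↦k
    k∈τ : InSupp ℝ τ k
    k∈τ = subst (InSupp ℝ τ) u↦k (u 1 , u-steps 0 0<q)
    lasso : ∃ λ b₀ → ∀ t → t ≤ℕ p → v t ≡ orb (t + b₀)
    lasso = cycle-on-orbit {a = q + 0} cycle j₀<p (trans (sym u↦v) (on-walk q ≤ℕ-refl))
    b₀ : ℕ
    b₀ = proj₁ lasso
    on-cycle : ∀ t → t ≤ℕ p → v t ≡ orb (t + b₀)
    on-cycle = proj₂ lasso
    node : (∃ λ j → j < p × v j ≡ i) ⊎ (∃ λ s → s < q × u s ≡ i) → LeAt ℝ i y x
    node (inj₁ (j₁ , j₁<p , v↦i)) = lasso-≤ nonneg strat k∈τ cycle weight on-cycle (j₁ + b₀)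
      (trans (sym (on-cycle j₁ (<⇒≤ j₁<p))) v↦i) X Y
    node (inj₂ (s , s<q , u↦i)) = lasso-≤ nonneg strat k∈τ cycle weight on-cycle (s + 0)
      (trans (sym (on-walk s (<⇒≤ s<q))) u↦i) X Y
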